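{- Let $n\ge1$, $v\ge0$ be integers and $\mu=(\mu_1\ge\mu_2\ge\cdots\ge\mu_n\ge0)$ an integer vector. Then $$R_v\,s_\mu[X_n]=\sum_{i=1}^nq^{v+\mu_i+n-i}\,s_{\mu+ve_i}[X_n],$$ where $e_i$ is the $i$-th coordinate vector of length $n$.
   Context: $X_n=x_1+\cdots+x_n$; $q$ is an indeterminate. $\Delta[X_n]=\prod_{1\le i<j\le n}(x_i-x_j)=\sum_{\sigma\in S_n}\epsilon(\sigma)\,\sigma x^{\delta}$ with $\delta=(n-1,n-2,\dots,0)$. $T^q_{x_i}$ is the substitution $x_i\mapsto qx_i$. For a symmetric polynomial $P$ in $x_1,\dots,x_n$, $R_vP=\frac{1}{\Delta[X_n]}\sum_{i=1}^nT^q_{x_i}\big(x_i^v\,\Delta[X_n]\,P\big)$. For $\alpha\in\mathbb{Z}_{\ge0}^n$, $s_\alpha[X_n]=\frac{1}{\Delta[X_n]}\sum_{\sigma\in S_n}\epsilon(\sigma)\,\sigma x^{\alpha+\delta}$ (for $\alpha$ a partition this is the Schur polynomial). -}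

module Defs where

open import Data.Nat as ℕ using (ℕ; zero; suc; _+_; _∸_; _≤_; _<ᵇ_; _≡ᵇ_)
open import Data.Integer as ℤ using (ℤ; +_)
open import Data.Fin as F using (Fin; toℕ)
open import Data.Bool using (Bool; true; false; if_then_else_; _∧_; _∨_; not)
open import Data.Bool.ListAction using (and)
open import Data.Nat.ListAction using (sum)
open import Data.Vec as V using (Vec; lookup; tabulate; zipWith)
open import Data.Vec.Properties using (≡-dec)
open import Data.List as L using (List; []; _∷_; [_]; _++_; map; concatMap; allFin; filterᵇ; length; foldr)
open import Relation.Nullary.Decidable using (does)
open import Relation.Binary.PropositionalEquality using (_≡_)
open import Data.Product using (_×_; _,_)

-- Polynomials in x_1..x_n with coefficients in ℤ[q], as finite formal
-- sums of terms  c · q^k · x^α  (c ∈ ℤ, k ∈ ℕ, α ∈ ℕ^n).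

record Term (n : ℕ) : Set where
  constructor term
  field
    coef : ℤ
    qdeg : ℕ
    xdeg : Vec ℕ n

Poly : ℕ → Set
Poly n = List (Term n)

private
  variable n : ℕ

0ₚ : Poly n
0ₚ = []

_⊕_ : Poly n → Poly n → Poly n
_⊕_ = _++_

mulT : Term n → Term n → Term n
mulT (term c k α) (term d l β) = term (c ℤ.* d) (k + l) (zipWith _+_ α β)

_⊗_ : Poly n → Poly n → Poly n
p ⊗ r = concatMap (λ a → map (mulT a) r) p

Σ[_] : (Fin n → Poly n) → Poly n
Σ[_] {n} f = concatMap f (allFin n)

x^ : Vec ℕ n → Poly n
x^ α = [ term (+ 1) 0 α ]

q^ : ℕ → Poly n
q^ k = [ term (+ 1) k (V.replicate _ 0) ]

e : Fin n → Vec ℕ n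
e i = tabulate (λ j → if does (i F.≟ j) then 1 else 0)

ve : ℕ → Fin n → Vec ℕ n
ve v i = V.map (v ℕ.*_) (e i)

xpow : Fin n → ℕ → Poly n
xpow i v = x^ (tabulate (λ j → if does (i F.≟ j) then v else 0))

coeff : Poly n → ℕ → Vec ℕ n → ℤ
coeff [] k α = + 0
coeff (term c l β ∷ p) k α =
  (if does (l ℕ.≟ k) ∧ does (≡-dec ℕ._≟_ β α) then c else + 0) ℤ.+ coeff p k α

infix 4 _≈_
_≈_ : Poly n → Poly n → Set
p ≈ r = ∀ k α → coeff p k α ≡ coeff r k α

-- T^q_{x_i} : x_i ↦ q x_i
Tq : Fin n → Poly n → Poly n
Tq i = map (λ { (term c k α) → term c (k + lookup α i) α })

-- The symmetric group S_n: maps Fin n → Fin n (as vectors of images)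
-- that are injective; sign via number of inversions.

allVecs : (n m : ℕ) → List (Vec (Fin n) m)
allVecs n zero = [ V.[] ]
allVecs n (suc m) = concatMap (λ i → map (i V.∷_) (allVecs n m)) (allFin n)

pairs : (n : ℕ) → List (Fin n × Fin n)
pairs n = concatMap (λ i → map (i ,_) (allFin n)) (allFin n)

_<ꟳ_ : Fin n → Fin n → Bool
i <ꟳ j = toℕ i <ᵇ toℕ j

isInjective : Vec (Fin n) n → Bool
isInjective {n} σ =
  and (map (λ { (i , j) → not (i <ꟳ j) ∨ not (does (lookup σ i F.≟ lookup σ j)) }) (pairs n))

perms : (n : ℕ) → List (Vec (Fin n) n)
perms n = filterᵇ isInjective (allVecs n n)

inversions : Vec (Fin n) n → ℕ
inversions {n} σ =
  length (filterᵇ (λ { (i , j) → (i <ꟳ j) ∧ (lookup σ j <ꟳ lookup σ i) }) (pairs n))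

sign : Vec (Fin n) n → ℤ
sign σ = (ℤ.- (+ 1)) ℤ.^ inversions σ

-- exponent vector of σ x^α = ∏_j x_{σ(j)}^{α_j}
permuteExp : Vec (Fin n) n → Vec ℕ n → Vec ℕ n
permuteExp {n} σ α =
  tabulate (λ k → sum (map (λ j → if does (lookup σ j F.≟ k) then lookup α j else 0) (allFin n)))

alt : Vec ℕ n → Poly n
alt {n} α = map (λ σ → term (sign σ) 0 (permuteExp σ α)) (perms n)

-- δ = (n-1, n-2, ..., 0)  (index i : Fin n is the (i+1)-th entry)
δ : (n : ℕ) → Vec ℕ n
δ n = tabulate (λ i → n ∸ suc (toℕ i))

-- Δ[X_n] = Σ_σ ε(σ) σ x^δ  ( = ∏_{i<j} (x_i - x_j) )
Δ : (n : ℕ) → Poly n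
Δ n = alt (δ n)

-- s is s_α[X_n]:  Δ · s = Σ_σ ε(σ) σ x^{α+δ}   (s_α is the exact quotient)
IsSchur : Vec ℕ n → Poly n → Set
IsSchur {n} α s = Δ n ⊗ s ≈ alt (zipWith _+_ α (δ n))

-- R is R_v P:  Δ · R = Σ_i T^q_{x_i}(x_i^v Δ P)
IsRv : ℕ → Poly n → Poly n → Set
IsRv {n} v P R = Δ n ⊗ R ≈ Σ[ (λ i → Tq i (xpow i v ⊗ (Δ n ⊗ P))) ]

IsPartition : Vec ℕ n → Set
IsPartition {n} μ = ∀ (i j : Fin n) → toℕ i ≤ toℕ j → lookup μ j ≤ lookup μ i

-- Multiplying by Δ turns a Schur polynomial s_α into the alternant a_(α+δ) = Σ_σ ε(σ) σx^(α+δ), and Δ · R_v s_μ into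
-- Σ_i T_(x_i)(x_i^v a_(μ+δ)). On a single term of an alternant, reindexing i = σ(j) gives
-- T_(x_σ(j))(x_σ(j)^v σx^β) = q^(v+β_j) σx^(β+v e_j), hence Σ_i T_(x_i)(x_i^v a_β) = Σ_j q^(v+β_j) a_(β+v e_j); for β = μ + δ
-- this is Δ times the claimed right-hand side. It remains to cancel Δ. Weigh monomials by β ↦ Σ_k β_k δ_k: by the
-- rearrangement inequality σx^δ is strictly lighter than x^δ unless σ fixes δ, so if P ≠ 0 and x^α₀ is a heaviest monomial
-- of P, the coefficient of x^(δ+α₀) in Δ · P is the number of σ fixing δ times the (nonzero) coefficient of x^α₀ in P.

module Submission where

open import Defs

open import Level using (Level; 0ℓ)
open import Function using (_∘_; id; _⇔_; mk⇔; Equivalence; Injective)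
open import Relation.Binary.PropositionalEquality hiding ([_])
open import Relation.Binary.Bundles using (Setoid)
open import Relation.Binary.Definitions using (tri<; tri≈; tri>)
import Relation.Binary.Reasoning.Setoid as SetoidReasoning
open import Relation.Nullary using (Dec; yes; no; ¬_; ¬?; does; contradiction; _×-dec_)
open import Relation.Nullary.Decidable using (dec-true; dec-false; T?; does-⇔)
import Algebra.Properties.CommutativeMonoid.Sum as CommutativeMonoidSum
import Algebra.Properties.CommutativeSemigroup as CommutativeSemigroupProperties
import Algebra.Properties.Semiring.Sum as SemiringSum
open import Data.Bool using (true; false; if_then_else_; T; not; _∧_)
import Data.Bool.Properties as BP
open import Data.Product using (_×_; _,_; proj₁; proj₂; ∃; ∃₂)
open import Data.Sum using (_⊎_; inj₁; inj₂)
open import Data.Nat as ℕ using (ℕ; zero; suc; _+_; _*_; _∸_; _≤_; _<_; ∣_-_∣)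
import Data.Nat.ListAction as ℕL
import Data.Nat.Properties as ℕP
import Data.Nat.Tactic.RingSolver as ℕ-Solver
open import Data.Integer using (ℤ; +_)
import Data.Integer as ℤ using (_+_; _*_; _^_; -_; _-_; _≟_)
import Data.Integer.Properties as ℤP
import Data.Integer.Tactic.RingSolver as ℤ-Solver
open import Data.Fin as F using (Fin; toℕ; zero; suc)
import Data.Fin.Properties as FP
open import Data.Fin.Permutation using (Permutation′; permutation; flip; _⟨$⟩ʳ_; _⟨$⟩ˡ_; inverseˡ; inverseʳ)
open import Data.List as L using (List; []; _∷_; [_]; _++_; map; concatMap; allFin; filter; length)
import Data.List.Properties as LP
open import Data.List.Membership.Propositional using (_∈_)
open import Data.List.Membership.Propositional.Properties using (∈-map⁺; ∈-concatMap⁺; ∈-allFin; ∈-filter⁺; ∈-filter⁻)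
open import Data.List.Relation.Unary.Any as Any using (here; there)
open import Data.List.Relation.Unary.All as All using (All)
open import Data.List.Relation.Unary.All.Properties using (all⁺; all⁻; all-filter)
open import Data.List.Extrema.Nat using (argmax; argmax-all; f[xs]≤f[argmax])
open import Data.Vec as V using (Vec; lookup; tabulate; zipWith)
import Data.Vec.Properties as VP
open import Data.Vec.Relation.Binary.Pointwise.Extensional using (ext; Pointwise-≡⇒≡)

private
  module ℤ∑ = CommutativeMonoidSum ℤP.+-0-commutativeMonoid
  module ℕ∑ = SemiringSum ℕP.+-*-semiring
  module ℤ* = CommutativeSemigroupProperties ℤP.*-commutativeSemigroup
  module ℕ+ = CommutativeSemigroupProperties ℕP.+-commutativeSemigroup

private variable
  a : Level
  A B : Set a
  n : ℕ

∑ : List A → (A → ℤ) → ℤ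
∑ []       f = + 0
∑ (x ∷ xs) f = f x ℤ.+ ∑ xs f

syntax ∑ xs (λ x → e) = ∑[ x ∈ xs ] e

∑-++ : ∀ (xs ys : List A) f → ∑ (xs ++ ys) f ≡ ∑ xs f ℤ.+ ∑ ys f
∑-++ []       ys f = sym (ℤP.+-identityˡ _)
∑-++ (x ∷ xs) ys f = trans (cong (ℤ._+_ (f x)) (∑-++ xs ys f)) (sym (ℤP.+-assoc (f x) _ _))

∑-map : ∀ (g : A → B) xs f → ∑ (map g xs) f ≡ ∑ xs (f ∘ g)
∑-map g []       f = refl
∑-map g (x ∷ xs) f = cong (ℤ._+_ (f (g x))) (∑-map g xs f)

∑-concatMap : ∀ (g : A → List B) xs f → ∑ (concatMap g xs) f ≡ ∑[ x ∈ xs ] ∑ (g x) f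
∑-concatMap g []       f = refl
∑-concatMap g (x ∷ xs) f = trans (∑-++ (g x) _ f) (cong (ℤ._+_ (∑ (g x) f)) (∑-concatMap g xs f))

∑-cong-∈ : ∀ (xs : List A) {f g} → (∀ {x} → x ∈ xs → f x ≡ g x) → ∑ xs f ≡ ∑ xs g
∑-cong-∈ []       f≡g = refl
∑-cong-∈ (x ∷ xs) f≡g = cong₂ ℤ._+_ (f≡g (here refl)) (∑-cong-∈ xs (f≡g ∘ there))

∑-cong : ∀ (xs : List A) {f g} → (∀ x → f x ≡ g x) → ∑ xs f ≡ ∑ xs g
∑-cong xs f≡g = ∑-cong-∈ xs (λ {x} _ → f≡g x)

∑-distrib-+ : ∀ (xs : List A) f g → ∑[ x ∈ xs ] (f x ℤ.+ g x) ≡ ∑ xs f ℤ.+ ∑ xs g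
∑-distrib-+ []       f g = refl
∑-distrib-+ (x ∷ xs) f g = trans (cong (ℤ._+_ (f x ℤ.+ g x)) (∑-distrib-+ xs f g)) (interchange (f x) (g x) _ _)
  where
  interchange : ∀ a b c d → a ℤ.+ b ℤ.+ (c ℤ.+ d) ≡ a ℤ.+ c ℤ.+ (b ℤ.+ d)
  interchange = ℤ-Solver.solve-∀

∑-distrib-− : ∀ (xs : List A) f g → ∑[ x ∈ xs ] (f x ℤ.- g x) ≡ ∑ xs f ℤ.- ∑ xs g
∑-distrib-− []       f g = refl
∑-distrib-− (x ∷ xs) f g = trans (cong (ℤ._+_ (f x ℤ.- g x)) (∑-distrib-− xs f g)) (interchange (f x) (g x) _ _)
  where
  interchange : ∀ a b c d → a ℤ.- b ℤ.+ (c ℤ.- d) ≡ a ℤ.+ c ℤ.- (b ℤ.+ d)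
  interchange = ℤ-Solver.solve-∀

∑-neg : ∀ (xs : List A) f → ∑[ x ∈ xs ] (ℤ.- f x) ≡ ℤ.- ∑ xs f
∑-neg []       f = refl
∑-neg (x ∷ xs) f = trans (cong (ℤ._+_ (ℤ.- f x)) (∑-neg xs f)) (sym (ℤP.neg-distrib-+ (f x) (∑ xs f)))

∑-zero : ∀ (xs : List A) {f} → (∀ x → f x ≡ + 0) → ∑ xs f ≡ + 0
∑-zero []       f≡0 = refl
∑-zero (x ∷ xs) f≡0 = cong₂ ℤ._+_ (f≡0 x) (∑-zero xs f≡0)

∑-*ˡ : ∀ c (xs : List A) f → c ℤ.* ∑ xs f ≡ ∑[ x ∈ xs ] (c ℤ.* f x)
∑-*ˡ c []       f = ℤP.*-zeroʳ c
∑-*ˡ c (x ∷ xs) f = trans (ℤP.*-distribˡ-+ c (f x) (∑ xs f)) (cong (ℤ._+_ (c ℤ.* f x)) (∑-*ˡ c xs f))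

∑-swap : ∀ (xs : List A) (ys : List B) (f : A → B → ℤ) → ∑[ x ∈ xs ] ∑[ y ∈ ys ] f x y ≡ ∑[ y ∈ ys ] ∑[ x ∈ xs ] f x y
∑-swap []       ys f = sym (∑-zero ys (λ _ → refl))
∑-swap (x ∷ xs) ys f =
  trans (cong (ℤ._+_ (∑ ys (f x))) (∑-swap xs ys f)) (sym (∑-distrib-+ ys (f x) (λ y → ∑[ x ∈ xs ] f x y)))

∑-nonzero : ∀ (xs : List A) f → ∑ xs f ≢ + 0 → ∃ λ x → x ∈ xs × f x ≢ + 0
∑-nonzero []       f ∑≢0 = contradiction refl ∑≢0
∑-nonzero (x ∷ xs) f ∑≢0 with f x ℤ.≟ + 0
... | no  fx≢0 = x , here refl , fx≢0
... | yes fx≡0 with y , y∈xs , fy≢0 ← ∑-nonzero xs f (∑≢0 ∘ cong₂ ℤ._+_ fx≡0)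
  = y , there y∈xs , fy≢0

∑-count : ∀ {P : A → Set} (P? : ∀ x → Dec (P x)) xs c →
          ∑[ x ∈ xs ] (if does (P? x) then c else + 0) ≡ + length (filter P? xs) ℤ.* c
∑-count P? []       c = refl
∑-count P? (x ∷ xs) c with does (P? x)
... | true  = trans (cong (ℤ._+_ c) (∑-count P? xs c)) (sym (ℤP.suc-* (+ length (filter P? xs)) c))
... | false = trans (ℤP.+-identityˡ _) (∑-count P? xs c)

∑-tabulate : ∀ (g : Fin n → A) f → ∑ (L.tabulate g) f ≡ ℤ∑.sum (f ∘ g)
∑-tabulate {zero}  g f = refl
∑-tabulate {suc n} g f = cong (ℤ._+_ (f (g zero))) (∑-tabulate (g ∘ suc) f)

∑-allFin-permute : ∀ (π : Permutation′ n) f → ∑[ i ∈ allFin n ] f i ≡ ∑[ j ∈ allFin n ] f (π ⟨$⟩ʳ j)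
∑-allFin-permute π f = trans (∑-tabulate id f) (trans (ℤ∑.∑-permute f π) (sym (∑-tabulate id (f ∘ (π ⟨$⟩ʳ_)))))

sum-tabulate : ∀ (g : Fin n → ℕ) → ℕL.sum (L.tabulate g) ≡ ℕ∑.sum g
sum-tabulate {zero}  g = refl
sum-tabulate {suc n} g = cong (_+_ (g zero)) (sum-tabulate (g ∘ suc))

sum-allFin : ∀ (g : Fin n → ℕ) → ℕL.sum (map g (allFin n)) ≡ ℕ∑.sum g
sum-allFin g = trans (cong ℕL.sum (LP.map-tabulate id g)) (sum-tabulate g)

sum-indicator : ∀ (j₀ : Fin n) (h : Fin n → ℕ) → ℕ∑.sum (λ j → if does (j F.≟ j₀) then h j else 0) ≡ h j₀
sum-indicator {suc n} zero     h = trans (cong (_+_ (h zero)) (ℕ∑.sum-replicate-zero n)) (ℕP.+-identityʳ _)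
sum-indicator {suc n} (suc j₀) h = sum-indicator j₀ (h ∘ suc)

term≤sum : ∀ (f : Fin n → ℕ) k → f k ≤ ℕ∑.sum f
term≤sum {suc n} f k = subst (f k ≤_) (sym (ℕ∑.sum-remove {i = k} f)) (ℕP.m≤m+n _ _)

infixl 6 _⊞_ _⊟_

_⊞_ : Vec ℕ n → Vec ℕ n → Vec ℕ n
_⊞_ = zipWith _+_

_⊟_ : Vec ℕ n → Vec ℕ n → Vec ℕ n
_⊟_ = zipWith _∸_

⊞-identityˡ : ∀ (β : Vec ℕ n) → V.replicate n 0 ⊞ β ≡ β
⊞-identityˡ = VP.zipWith-identityˡ ℕP.+-identityˡ

⊞-comm : ∀ (β γ : Vec ℕ n) → β ⊞ γ ≡ γ ⊞ β
⊞-comm = VP.zipWith-comm ℕP.+-comm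

⊞-assoc : ∀ (β γ ε : Vec ℕ n) → β ⊞ γ ⊞ ε ≡ β ⊞ (γ ⊞ ε)
⊞-assoc = VP.zipWith-assoc ℕP.+-assoc

⊞-cancelˡ : ∀ (β : Vec ℕ n) {γ ε} → β ⊞ γ ≡ β ⊞ ε → γ ≡ ε
⊞-cancelˡ V.[]       {V.[]}    {V.[]}    _  = refl
⊞-cancelˡ (b V.∷ β) {c V.∷ γ} {e V.∷ ε} eq =
  cong₂ V._∷_ (ℕP.+-cancelˡ-≡ b c e (cong V.head eq)) (⊞-cancelˡ β (cong V.tail eq))

⊞-⊟ : ∀ (β γ : Vec ℕ n) → β ⊞ γ ⊟ β ≡ γ
⊞-⊟ V.[]       V.[]       = refl
⊞-⊟ (b V.∷ β) (c V.∷ γ) = cong₂ V._∷_ (ℕP.m+n∸m≡n b c) (⊞-⊟ β γ)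

⊞-left-comm : ∀ (β γ ε : Vec ℕ n) → β ⊞ (γ ⊞ ε) ≡ γ ⊞ (β ⊞ ε)
⊞-left-comm β γ ε = trans (sym (⊞-assoc β γ ε)) (trans (cong (_⊞ ε) (⊞-comm β γ)) (⊞-assoc γ β ε))

⊞-right-comm : ∀ (β γ ε : Vec ℕ n) → β ⊞ γ ⊞ ε ≡ β ⊞ ε ⊞ γ
⊞-right-comm β γ ε = trans (⊞-assoc β γ ε) (trans (cong (β ⊞_) (⊞-comm γ ε)) (sym (⊞-assoc β ε γ)))

open Term

if-does-yes : ∀ {P : Set a} (P? : Dec P) {x y : A} → P → (if does P? then x else y) ≡ x
if-does-yes P? p rewrite dec-true P? p = refl

if-does-no : ∀ {P : Set a} (P? : Dec P) {x y : A} → ¬ P → (if does P? then x else y) ≡ y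
if-does-no P? ¬p rewrite dec-false P? ¬p = refl

Matches : Term n → ℕ → Vec ℕ n → Set
Matches t k α = qdeg t ≡ k × xdeg t ≡ α

matches? : ∀ (t : Term n) k α → Dec (Matches t k α)
matches? t k α = qdeg t ℕ.≟ k ×-dec VP.≡-dec ℕ._≟_ (xdeg t) α

coeffᵗ : Term n → ℕ → Vec ℕ n → ℤ
coeffᵗ t k α = if does (matches? t k α) then coef t else + 0

coeff-∑ : ∀ (p : Poly n) k α → coeff p k α ≡ ∑[ t ∈ p ] coeffᵗ t k α
coeff-∑ []      k α = refl
coeff-∑ (t ∷ p) k α = cong (ℤ._+_ (coeffᵗ t k α)) (coeff-∑ p k α)

coeffᵗ-match : ∀ (t : Term n) → coeffᵗ t (qdeg t) (xdeg t) ≡ coef t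
coeffᵗ-match t = if-does-yes (matches? t _ _) (refl , refl)

coeffᵗ-mismatch : ∀ (t : Term n) {k α} → ¬ Matches t k α → coeffᵗ t k α ≡ + 0
coeffᵗ-mismatch t = if-does-no (matches? t _ _)

coeffᵗ-nonzero : ∀ (t : Term n) {k α} → coeffᵗ t k α ≢ + 0 → Matches t k α
coeffᵗ-nonzero t {k} {α} nonzero with matches? t k α
... | yes match  = match
... | no  ¬match = contradiction (coeffᵗ-mismatch t ¬match) nonzero

support : ∀ (p : Poly n) {k α} → coeff p k α ≢ + 0 → ∃ λ t → t ∈ p × Matches t k α
support p {k} {α} nonzero with t , t∈p , coeffᵗ≢0 ← ∑-nonzero p _ (nonzero ∘ trans (coeff-∑ p k α))
  = t , t∈p , coeffᵗ-nonzero t coeffᵗ≢0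

term-cong : ∀ {c c′ k k′} {α α′ : Vec ℕ n} → c ≡ c′ → k ≡ k′ → α ≡ α′ → term c k α ≡ term c′ k′ α′
term-cong refl refl refl = refl

≈-setoid : ℕ → Setoid 0ℓ 0ℓ
≈-setoid n = record
  { Carrier       = Poly n
  ; _≈_           = _≈_
  ; isEquivalence = record
    { refl  = λ _ _ → refl
    ; sym   = λ p≈r k α → sym (p≈r k α)
    ; trans = λ p≈r r≈s k α → trans (p≈r k α) (r≈s k α)
    }
  }

infixr 7 _·ᵗ_

_·ᵗ_ : Term n → Poly n → Poly n
t ·ᵗ p = map (mulT t) p

_∣ᵗ_ : Term n → ℕ × Vec ℕ n → Set
t ∣ᵗ (k , α) = ∃₂ λ k′ α′ → k ≡ qdeg t + k′ × α ≡ xdeg t ⊞ α′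

-- t divides the monomial exactly when subtracting its exponents and adding them back is lossless.
_∣ᵗ?_ : ∀ (t : Term n) kα → Dec (t ∣ᵗ kα)
t ∣ᵗ? (k , α) with qdeg t + (k ∸ qdeg t) ℕ.≟ k | VP.≡-dec ℕ._≟_ (xdeg t ⊞ (α ⊟ xdeg t)) α
... | yes k≡ | yes α≡ = yes (k ∸ qdeg t , α ⊟ xdeg t , sym k≡ , sym α≡)
... | no  k≢ | _      = no λ { (k′ , _ , refl , _) → k≢ (cong (_+_ (qdeg t)) (ℕP.m+n∸m≡n (qdeg t) k′)) }
... | yes _  | no α≢  = no λ { (_ , α′ , _ , refl) → α≢ (cong (xdeg t ⊞_) (⊞-⊟ (xdeg t) α′)) }

coeffᵗ-mulT : ∀ (t u : Term n) k α → coeffᵗ (mulT t u) (qdeg t + k) (xdeg t ⊞ α) ≡ coef t ℤ.* coeffᵗ u k α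
coeffᵗ-mulT t u k α with matches? u k α
... | yes (refl , refl) = trans (coeffᵗ-match (mulT t u)) (cong (ℤ._*_ (coef t)) (sym (coeffᵗ-match u)))
... | no  ¬match        = begin
  coeffᵗ (mulT t u) (qdeg t + k) (xdeg t ⊞ α) ≡⟨ coeffᵗ-mismatch (mulT t u) cancel ⟩
  + 0                                         ≡⟨ ℤP.*-zeroʳ (coef t) ⟨
  coef t ℤ.* + 0                              ≡⟨ cong (ℤ._*_ (coef t)) (coeffᵗ-mismatch u ¬match) ⟨
  coef t ℤ.* coeffᵗ u k α                     ∎
  where
  open ≡-Reasoning
  cancel : ¬ Matches (mulT t u) (qdeg t + k) (xdeg t ⊞ α)
  cancel (k≡ , α≡) = ¬match (ℕP.+-cancelˡ-≡ (qdeg t) _ _ k≡ , ⊞-cancelˡ (xdeg t) α≡)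

coeffᵗ-mulT-∤ : ∀ (t u : Term n) {k α} → ¬ t ∣ᵗ (k , α) → coeffᵗ (mulT t u) k α ≡ + 0
coeffᵗ-mulT-∤ t u t∤ = coeffᵗ-mismatch (mulT t u) λ { (refl , refl) → t∤ (qdeg u , xdeg u , refl , refl) }

coeff-·ᵗ : ∀ (t : Term n) r k α → coeff (t ·ᵗ r) k α ≡ ∑[ u ∈ r ] coeffᵗ (mulT t u) k α
coeff-·ᵗ t r k α = trans (coeff-∑ (t ·ᵗ r) k α) (∑-map (mulT t) r _)

coeff-·ᵗ-∣ : ∀ (t : Term n) r k α → coeff (t ·ᵗ r) (qdeg t + k) (xdeg t ⊞ α) ≡ coef t ℤ.* coeff r k α
coeff-·ᵗ-∣ t r k α = begin
  coeff (t ·ᵗ r) (qdeg t + k) (xdeg t ⊞ α)             ≡⟨ coeff-·ᵗ t r _ _ ⟩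
  ∑[ u ∈ r ] coeffᵗ (mulT t u) (qdeg t + k) (xdeg t ⊞ α) ≡⟨ ∑-cong r (λ u → coeffᵗ-mulT t u k α) ⟩
  ∑[ u ∈ r ] (coef t ℤ.* coeffᵗ u k α)                  ≡⟨ ∑-*ˡ (coef t) r _ ⟨
  coef t ℤ.* ∑[ u ∈ r ] coeffᵗ u k α                    ≡⟨ cong (ℤ._*_ (coef t)) (coeff-∑ r k α) ⟨
  coef t ℤ.* coeff r k α                                ∎
  where open ≡-Reasoning

coeff-·ᵗ-∤ : ∀ (t : Term n) r {k α} → ¬ t ∣ᵗ (k , α) → coeff (t ·ᵗ r) k α ≡ + 0
coeff-·ᵗ-∤ t r t∤ = trans (coeff-·ᵗ t r _ _) (∑-zero r (λ u → coeffᵗ-mulT-∤ t u t∤))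

·ᵗ-cong : ∀ (t : Term n) {r s} → r ≈ s → t ·ᵗ r ≈ t ·ᵗ s
·ᵗ-cong t {r} {s} r≈s k α with t ∣ᵗ? (k , α)
... | yes (k′ , α′ , refl , refl) =
  trans (coeff-·ᵗ-∣ t r k′ α′) (trans (cong (ℤ._*_ (coef t)) (r≈s k′ α′)) (sym (coeff-·ᵗ-∣ t s k′ α′)))
... | no t∤ = trans (coeff-·ᵗ-∤ t r t∤) (sym (coeff-·ᵗ-∤ t s t∤))

coeff-⊗ : ∀ (p r : Poly n) k α → coeff (p ⊗ r) k α ≡ ∑[ t ∈ p ] coeff (t ·ᵗ r) k α
coeff-⊗ p r k α = trans (coeff-∑ (p ⊗ r) k α)
  (trans (∑-concatMap (_·ᵗ r) p _) (∑-cong p (λ t → sym (coeff-∑ (t ·ᵗ r) k α))))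

⊗-congʳ : ∀ (p : Poly n) {r s} → r ≈ s → p ⊗ r ≈ p ⊗ s
⊗-congʳ p {r} {s} r≈s k α =
  trans (coeff-⊗ p r k α) (trans (∑-cong p (λ t → ·ᵗ-cong t {r} {s} r≈s k α)) (sym (coeff-⊗ p s k α)))

coeff-·ᵗ-⊗ : ∀ (t : Term n) r s k α →
             coeff (t ·ᵗ (r ⊗ s)) k α ≡ ∑[ u ∈ r ] ∑[ v ∈ s ] coeffᵗ (mulT t (mulT u v)) k α
coeff-·ᵗ-⊗ t r s k α = begin
  coeff (t ·ᵗ (r ⊗ s)) k α                            ≡⟨ coeff-·ᵗ t (r ⊗ s) k α ⟩
  ∑[ w ∈ r ⊗ s ] coeffᵗ (mulT t w) k α                ≡⟨ ∑-concatMap (_·ᵗ s) r _ ⟩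
  ∑[ u ∈ r ] ∑[ w ∈ u ·ᵗ s ] coeffᵗ (mulT t w) k α     ≡⟨ ∑-cong r (λ u → ∑-map (mulT u) s _) ⟩
  ∑[ u ∈ r ] ∑[ v ∈ s ] coeffᵗ (mulT t (mulT u v)) k α ∎
  where open ≡-Reasoning

mulT-left-comm : ∀ (t u v : Term n) → mulT t (mulT u v) ≡ mulT u (mulT t v)
mulT-left-comm (term c k β) (term d l γ) (term e m ε) =
  term-cong (ℤ*.x∙yz≈y∙xz c d e) (ℕ+.x∙yz≈y∙xz k l m) (⊞-left-comm β γ ε)

⊗-left-comm : ∀ (p r s : Poly n) → p ⊗ (r ⊗ s) ≈ r ⊗ (p ⊗ s)
⊗-left-comm p r s k α = begin
  coeff (p ⊗ (r ⊗ s)) k α                                            ≡⟨ coeff-⊗ p (r ⊗ s) k α ⟩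
  ∑[ t ∈ p ] coeff (t ·ᵗ (r ⊗ s)) k α                                ≡⟨ ∑-cong p (λ t → coeff-·ᵗ-⊗ t r s k α) ⟩
  ∑[ t ∈ p ] ∑[ u ∈ r ] ∑[ v ∈ s ] coeffᵗ (mulT t (mulT u v)) k α     ≡⟨ ∑-swap p r _ ⟩
  ∑[ u ∈ r ] ∑[ t ∈ p ] ∑[ v ∈ s ] coeffᵗ (mulT t (mulT u v)) k α     ≡⟨ ∑-cong r (λ u → ∑-cong p (λ t → ∑-cong s (λ v →
                                                                           cong (λ w → coeffᵗ w k α) (mulT-left-comm t u v)))) ⟩
  ∑[ u ∈ r ] ∑[ t ∈ p ] ∑[ v ∈ s ] coeffᵗ (mulT u (mulT t v)) k α     ≡⟨ ∑-cong r (λ u → coeff-·ᵗ-⊗ u p s k α) ⟨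
  ∑[ u ∈ r ] coeff (u ·ᵗ (p ⊗ s)) k α                                ≡⟨ coeff-⊗ r (p ⊗ s) k α ⟨
  coeff (r ⊗ (p ⊗ s)) k α                                            ∎
  where open ≡-Reasoning

coeff-Σ : ∀ (f : Fin n → Poly n) k α → coeff (Σ[ f ]) k α ≡ ∑[ i ∈ allFin n ] coeff (f i) k α
coeff-Σ {n} f k α =
  trans (coeff-∑ (Σ[ f ]) k α) (trans (∑-concatMap f (allFin n) _) (∑-cong (allFin n) (λ i → sym (coeff-∑ (f i) k α))))

Σ-cong : ∀ {f g : Fin n → Poly n} → (∀ i → f i ≈ g i) → Σ[ f ] ≈ Σ[ g ]
Σ-cong {n} {f} {g} f≈g k α = trans (coeff-Σ f k α) (trans (∑-cong (allFin n) (λ i → f≈g i k α)) (sym (coeff-Σ g k α)))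

⊗-distrib-Σ : ∀ (p : Poly n) f → p ⊗ Σ[ f ] ≈ Σ[ (λ i → p ⊗ f i) ]
⊗-distrib-Σ {n} p f k α = begin
  coeff (p ⊗ Σ[ f ]) k α                                    ≡⟨ coeff-⊗ p (Σ[ f ]) k α ⟩
  ∑[ t ∈ p ] coeff (t ·ᵗ Σ[ f ]) k α                        ≡⟨ ∑-cong p distrib ⟩
  ∑[ t ∈ p ] ∑[ i ∈ allFin n ] coeff (t ·ᵗ f i) k α          ≡⟨ ∑-swap p (allFin n) _ ⟩
  ∑[ i ∈ allFin n ] ∑[ t ∈ p ] coeff (t ·ᵗ f i) k α          ≡⟨ ∑-cong (allFin n) (λ i → coeff-⊗ p (f i) k α) ⟨
  ∑[ i ∈ allFin n ] coeff (p ⊗ f i) k α                     ≡⟨ coeff-Σ (λ i → p ⊗ f i) k α ⟨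
  coeff (Σ[ (λ i → p ⊗ f i) ]) k α                          ∎
  where
  open ≡-Reasoning
  distrib : ∀ t → coeff (t ·ᵗ Σ[ f ]) k α ≡ ∑[ i ∈ allFin n ] coeff (t ·ᵗ f i) k α
  distrib t = trans (coeff-·ᵗ t (Σ[ f ]) k α)
    (trans (∑-concatMap f (allFin n) _) (∑-cong (allFin n) (λ i → sym (coeff-·ᵗ t (f i) k α))))

negᵗ : Term n → Term n
negᵗ (term c k α) = term (ℤ.- c) k α

infixl 6 _⊖_

_⊖_ : Poly n → Poly n → Poly n
p ⊖ r = p ⊕ map negᵗ r

coeffᵗ-negᵗ : ∀ (t : Term n) k α → coeffᵗ (negᵗ t) k α ≡ ℤ.- coeffᵗ t k α
coeffᵗ-negᵗ t k α = sym (BP.if-float ℤ.-_ (does (matches? t k α)))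

coeff-⊖ : ∀ (p r : Poly n) k α → coeff (p ⊖ r) k α ≡ coeff p k α ℤ.- coeff r k α
coeff-⊖ p r k α = trans (coeff-∑ (p ⊖ r) k α) (trans (∑-++ p (map negᵗ r) _) (cong₂ ℤ._+_ (sym (coeff-∑ p k α)) negated))
  where
  negated : ∑[ u ∈ map negᵗ r ] coeffᵗ u k α ≡ ℤ.- coeff r k α
  negated = begin
    ∑[ u ∈ map negᵗ r ] coeffᵗ u k α ≡⟨ ∑-map negᵗ r _ ⟩
    ∑[ u ∈ r ] coeffᵗ (negᵗ u) k α   ≡⟨ ∑-cong r (λ u → coeffᵗ-negᵗ u k α) ⟩
    ∑[ u ∈ r ] (ℤ.- coeffᵗ u k α)    ≡⟨ ∑-neg r _ ⟩
    ℤ.- ∑[ u ∈ r ] coeffᵗ u k α      ≡⟨ cong ℤ.-_ (coeff-∑ r k α) ⟨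
    ℤ.- coeff r k α                  ∎
    where open ≡-Reasoning

coeff-·ᵗ-⊖ : ∀ (t : Term n) r s k α → coeff (t ·ᵗ (r ⊖ s)) k α ≡ coeff (t ·ᵗ r) k α ℤ.- coeff (t ·ᵗ s) k α
coeff-·ᵗ-⊖ t r s k α with t ∣ᵗ? (k , α)
... | yes (k′ , α′ , refl , refl) = begin
  coeff (t ·ᵗ (r ⊖ s)) (qdeg t + k′) (xdeg t ⊞ α′)                   ≡⟨ coeff-·ᵗ-∣ t (r ⊖ s) k′ α′ ⟩
  coef t ℤ.* coeff (r ⊖ s) k′ α′                                    ≡⟨ cong (ℤ._*_ (coef t)) (coeff-⊖ r s k′ α′) ⟩
  coef t ℤ.* (coeff r k′ α′ ℤ.- coeff s k′ α′)                       ≡⟨ *-distribˡ-− (coef t) _ _ ⟩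
  coef t ℤ.* coeff r k′ α′ ℤ.- coef t ℤ.* coeff s k′ α′               ≡⟨ cong₂ ℤ._-_ (coeff-·ᵗ-∣ t r k′ α′) (coeff-·ᵗ-∣ t s k′ α′) ⟨
  coeff (t ·ᵗ r) (qdeg t + k′) (xdeg t ⊞ α′) ℤ.- coeff (t ·ᵗ s) (qdeg t + k′) (xdeg t ⊞ α′) ∎
  where
  open ≡-Reasoning
  *-distribˡ-− : ∀ a b c → a ℤ.* (b ℤ.- c) ≡ a ℤ.* b ℤ.- a ℤ.* c
  *-distribˡ-− = ℤ-Solver.solve-∀
... | no t∤ = trans (coeff-·ᵗ-∤ t (r ⊖ s) t∤) (sym (cong₂ ℤ._-_ (coeff-·ᵗ-∤ t r t∤) (coeff-·ᵗ-∤ t s t∤)))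

coeff-⊗-⊖ : ∀ (p r s : Poly n) k α → coeff (p ⊗ (r ⊖ s)) k α ≡ coeff (p ⊗ r) k α ℤ.- coeff (p ⊗ s) k α
coeff-⊗-⊖ p r s k α = begin
  coeff (p ⊗ (r ⊖ s)) k α                                         ≡⟨ coeff-⊗ p (r ⊖ s) k α ⟩
  ∑[ t ∈ p ] coeff (t ·ᵗ (r ⊖ s)) k α                             ≡⟨ ∑-cong p (λ t → coeff-·ᵗ-⊖ t r s k α) ⟩
  ∑[ t ∈ p ] (coeff (t ·ᵗ r) k α ℤ.- coeff (t ·ᵗ s) k α)           ≡⟨ ∑-distrib-− p _ _ ⟩
  ∑[ t ∈ p ] coeff (t ·ᵗ r) k α ℤ.- ∑[ t ∈ p ] coeff (t ·ᵗ s) k α   ≡⟨ cong₂ ℤ._-_ (coeff-⊗ p r k α) (coeff-⊗ p s k α) ⟨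
  coeff (p ⊗ r) k α ℤ.- coeff (p ⊗ s) k α                         ∎
  where open ≡-Reasoning

qᵗ : ℕ → Term n
qᵗ m = term (+ 1) m (V.replicate _ 0)

Tqᵗ : Fin n → Term n → Term n
Tqᵗ i (term c k α) = term c (k + lookup α i) α

Tqᵗ≡mulT-qᵗ : ∀ (i : Fin n) u → Tqᵗ i u ≡ mulT (qᵗ (lookup (xdeg u) i)) u
Tqᵗ≡mulT-qᵗ i u = term-cong (sym (ℤP.*-identityˡ (coef u))) (ℕP.+-comm (qdeg u) _) (sym (⊞-identityˡ (xdeg u)))

coeff-Tq : ∀ (i : Fin n) p k α → coeff (Tq i p) k α ≡ coeff (qᵗ (lookup α i) ·ᵗ p) k α
coeff-Tq i p k α = begin
  coeff (Tq i p) k α                              ≡⟨ trans (coeff-∑ (Tq i p) k α) (∑-map (Tqᵗ i) p _) ⟩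
  ∑[ u ∈ p ] coeffᵗ (Tqᵗ i u) k α                 ≡⟨ ∑-cong p (λ u → termwise u (VP.≡-dec ℕ._≟_ (xdeg u) α)) ⟩
  ∑[ u ∈ p ] coeffᵗ (mulT (qᵗ (lookup α i)) u) k α ≡⟨ coeff-·ᵗ (qᵗ (lookup α i)) p k α ⟨
  coeff (qᵗ (lookup α i) ·ᵗ p) k α                ∎
  where
  open ≡-Reasoning
  termwise : ∀ u → Dec (xdeg u ≡ α) → coeffᵗ (Tqᵗ i u) k α ≡ coeffᵗ (mulT (qᵗ (lookup α i)) u) k α
  termwise u (yes refl) = cong (λ w → coeffᵗ w k α) (Tqᵗ≡mulT-qᵗ i u)
  termwise u (no α≢)    = trans (coeffᵗ-mismatch (Tqᵗ i u) (α≢ ∘ proj₂))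
                              (sym (coeffᵗ-mismatch (mulT (qᵗ (lookup α i)) u) (α≢ ∘ trans (sym (⊞-identityˡ _)) ∘ proj₂)))

Tq-cong : ∀ (i : Fin n) {p r} → p ≈ r → Tq i p ≈ Tq i r
Tq-cong i {p} {r} p≈r k α = trans (coeff-Tq i p k α) (trans (·ᵗ-cong (qᵗ (lookup α i)) {p} {r} p≈r k α) (sym (coeff-Tq i r k α)))

-- Permutations

T-not : ∀ {b} → T b → ¬ T (not b)
T-not {true} _ ()

¬T⇒T-not : ∀ {b} → ¬ T b → T (not b)
¬T⇒T-not {false} _  = _
¬T⇒T-not {true}  ¬t = ¬t _

∈-pairs : ∀ (i j : Fin n) → (i , j) ∈ pairs n
∈-pairs {n} i j = ∈-concatMap⁺ (λ i → map (i ,_) (allFin n)) (Any.map (λ { refl → ∈-map⁺ (i ,_) (∈-allFin j) }) (∈-allFin i))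

∈-allVecs : ∀ m (σ : Vec (Fin n) m) → σ ∈ allVecs n m
∈-allVecs zero    V.[]       = here refl
∈-allVecs {n} (suc m) (i V.∷ σ) =
  ∈-concatMap⁺ (λ i → map (i V.∷_) (allVecs n m)) (Any.map (λ { refl → ∈-map⁺ (i V.∷_) (∈-allVecs m σ) }) (∈-allFin i))

isInjective⇔Injective : ∀ (σ : Vec (Fin n) n) → T (isInjective σ) ⇔ Injective _≡_ _≡_ (lookup σ)
isInjective⇔Injective {n} σ = mk⇔ sound complete
  where
  ordered-distinct : T (isInjective σ) → ∀ {i j} → toℕ i < toℕ j → lookup σ i ≢ lookup σ j
  ordered-distinct inj {i} {j} i<j σi≡σj with Equivalence.to BP.T-∨ (All.lookup (all⁺ _ (pairs n) inj) (∈-pairs i j))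
  ... | inj₁ i≮j  = T-not (ℕP.<⇒<ᵇ i<j) i≮j
  ... | inj₂ σi≢σj = T-not (Equivalence.from BP.T-≡ (dec-true (lookup σ i F.≟ lookup σ j) σi≡σj)) σi≢σj

  sound : T (isInjective σ) → Injective _≡_ _≡_ (lookup σ)
  sound inj {i} {j} σi≡σj with ℕP.<-cmp (toℕ i) (toℕ j)
  ... | tri< i<j _ _ = contradiction σi≡σj (ordered-distinct inj i<j)
  ... | tri≈ _ i≡j _ = FP.toℕ-injective i≡j
  ... | tri> _ _ j<i = contradiction (sym σi≡σj) (ordered-distinct inj j<i)

  complete : Injective _≡_ _≡_ (lookup σ) → T (isInjective σ)
  complete inj = all⁻ _ {pairs n} (All.tabulate λ { {i , j} _ → Equivalence.from BP.T-∨ (pair-ok i j (lookup σ i F.≟ lookup σ j)) })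
    where
    pair-ok : ∀ i j (σi≟σj : Dec (lookup σ i ≡ lookup σ j)) → T (not (i <ꟳ j)) ⊎ T (not (does σi≟σj))
    pair-ok i j (yes σi≡σj) rewrite inj σi≡σj = inj₁ (¬T⇒T-not (ℕP.<-irrefl refl ∘ ℕP.<ᵇ⇒< (toℕ j) (toℕ j)))
    pair-ok i j (no σi≢σj)  = inj₂ _

injective⇒surjective : ∀ {f : Fin n → Fin n} → Injective _≡_ _≡_ f → ∀ k → ∃ λ j → f j ≡ k
injective⇒surjective {suc m} {f} f-injective k with FP.any? (λ j → f j F.≟ k)
... | yes found  = found
... | no  missed = contradiction (λ {i j} → punchOut∘f-injective {i} {j}) (FP.<⇒notInjective (ℕP.n<1+n m))
  where
  k≢f : ∀ j → k ≢ f j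
  k≢f j k≡fj = missed (j , sym k≡fj)
  punchOut∘f-injective : Injective _≡_ _≡_ (λ j → F.punchOut (k≢f j))
  punchOut∘f-injective {i} {j} eq = f-injective (FP.punchOut-injective (k≢f i) (k≢f j) eq)

permutationOf : ∀ {σ : Vec (Fin n) n} → σ ∈ perms n → Permutation′ n
permutationOf {n} {σ} σ∈perms =
  permutation (lookup σ) (proj₁ ∘ surjective) (proj₂ ∘ surjective) (λ j → injective (proj₂ (surjective (lookup σ j))))
  where
  injective : Injective _≡_ _≡_ (lookup σ)
  injective = Equivalence.to (isInjective⇔Injective σ) (proj₂ (∈-filter⁻ (T? ∘ isInjective) {xs = allVecs n n} σ∈perms))
  surjective = injective⇒surjective injective

identity-∈-perms : ∀ n → tabulate id ∈ perms n
identity-∈-perms n = ∈-filter⁺ (T? ∘ isInjective) (∈-allVecs n (tabulate id))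
  (Equivalence.from (isInjective⇔Injective (tabulate {n = n} id)) λ {i} {j} eq →
    trans (sym (VP.lookup∘tabulate id i)) (trans eq (VP.lookup∘tabulate id j)))

lookup-ve : ∀ v (j k : Fin n) → lookup (ve v j) k ≡ (if does (j F.≟ k) then v else 0)
lookup-ve v j k = trans (VP.lookup-map k (_*_ v) (e j)) (trans (cong (_*_ v) (VP.lookup∘tabulate _ k)) (scale (does (j F.≟ k))))
  where
  scale : ∀ b → v * (if b then 1 else 0) ≡ (if b then v else 0)
  scale true  = ℕP.*-identityʳ v
  scale false = ℕP.*-zeroʳ v

xexp : Fin n → ℕ → Vec ℕ n
xexp i v = tabulate (λ k → if does (i F.≟ k) then v else 0)

module _ {σ : Vec (Fin n) n} (σ∈perms : σ ∈ perms n) where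

  private
    π = permutationOf σ∈perms

  does-σ≟-inverse : ∀ j k → does (lookup σ j F.≟ k) ≡ does (j F.≟ π ⟨$⟩ˡ k)
  does-σ≟-inverse j k = does-⇔ (mk⇔ (λ σj≡k → trans (sym (inverseˡ π)) (cong (π ⟨$⟩ˡ_) σj≡k))
                                   (λ j≡π⁻¹k → trans (cong (π ⟨$⟩ʳ_) j≡π⁻¹k) (inverseʳ π)))
                               (lookup σ j F.≟ k) (j F.≟ π ⟨$⟩ˡ k)

  lookup-permuteExp : ∀ β k → lookup (permuteExp σ β) k ≡ lookup β (π ⟨$⟩ˡ k)
  lookup-permuteExp β k = begin
    lookup (permuteExp σ β) k                                                 ≡⟨ VP.lookup∘tabulate _ k ⟩
    ℕL.sum (map (λ j → if does (lookup σ j F.≟ k) then lookup β j else 0) (allFin n)) ≡⟨ sum-allFin (λ j → if does (lookup σ j F.≟ k) then lookup β j else 0) ⟩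
    ℕ∑.sum (λ j → if does (lookup σ j F.≟ k) then lookup β j else 0)          ≡⟨ ℕ∑.sum-cong-≗ (λ j →
                                                                                   cong (if_then lookup β j else 0) (does-σ≟-inverse j k)) ⟩
    ℕ∑.sum (λ j → if does (j F.≟ π ⟨$⟩ˡ k) then lookup β j else 0)            ≡⟨ sum-indicator _ (lookup β) ⟩
    lookup β (π ⟨$⟩ˡ k)                                                       ∎
    where open ≡-Reasoning

  lookup-permuteExp-σ : ∀ β j → lookup (permuteExp σ β) (lookup σ j) ≡ lookup β j
  lookup-permuteExp-σ β j = trans (lookup-permuteExp β (lookup σ j)) (cong (lookup β) (inverseˡ π))

  permuteExp-⊞ : ∀ β γ → permuteExp σ (β ⊞ γ) ≡ permuteExp σ β ⊞ permuteExp σ γ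
  permuteExp-⊞ β γ = Pointwise-≡⇒≡ (ext λ k → begin
    lookup (permuteExp σ (β ⊞ γ)) k                           ≡⟨ lookup-permuteExp (β ⊞ γ) k ⟩
    lookup (β ⊞ γ) (π ⟨$⟩ˡ k)                                 ≡⟨ VP.lookup-zipWith _+_ _ β γ ⟩
    lookup β (π ⟨$⟩ˡ k) + lookup γ (π ⟨$⟩ˡ k)                 ≡⟨ cong₂ _+_ (lookup-permuteExp β k) (lookup-permuteExp γ k) ⟨
    lookup (permuteExp σ β) k + lookup (permuteExp σ γ) k     ≡⟨ VP.lookup-zipWith _+_ k (permuteExp σ β) (permuteExp σ γ) ⟨
    lookup (permuteExp σ β ⊞ permuteExp σ γ) k                ∎)
    where open ≡-Reasoning

  permuteExp-ve : ∀ v j → permuteExp σ (ve v j) ≡ xexp (lookup σ j) v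
  permuteExp-ve v j = Pointwise-≡⇒≡ (ext λ k → begin
    lookup (permuteExp σ (ve v j)) k                  ≡⟨ lookup-permuteExp (ve v j) k ⟩
    lookup (ve v j) (π ⟨$⟩ˡ k)                        ≡⟨ lookup-ve v j _ ⟩
    (if does (j F.≟ π ⟨$⟩ˡ k) then v else 0)          ≡⟨ cong (if_then v else 0) (does-σ≟-inverse j k) ⟨
    (if does (lookup σ j F.≟ k) then v else 0)        ≡⟨ VP.lookup∘tabulate _ k ⟨
    lookup (xexp (lookup σ j) v) k                    ∎)
    where open ≡-Reasoning

  xexp-⊞-permuteExp : ∀ α v j → xexp (lookup σ j) v ⊞ permuteExp σ α ≡ permuteExp σ (α ⊞ ve v j)
  xexp-⊞-permuteExp α v j = begin
    xexp (lookup σ j) v ⊞ permuteExp σ α          ≡⟨ ⊞-comm _ (permuteExp σ α) ⟩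
    permuteExp σ α ⊞ xexp (lookup σ j) v          ≡⟨ cong (permuteExp σ α ⊞_) (permuteExp-ve v j) ⟨
    permuteExp σ α ⊞ permuteExp σ (ve v j)        ≡⟨ permuteExp-⊞ α (ve v j) ⟨
    permuteExp σ (α ⊞ ve v j)                     ∎
    where open ≡-Reasoning

  lookup-xexp-⊞-permuteExp : ∀ α v j → lookup (xexp (lookup σ j) v ⊞ permuteExp σ α) (lookup σ j) ≡ v + lookup α j
  lookup-xexp-⊞-permuteExp α v j = begin
    lookup (xexp (lookup σ j) v ⊞ permuteExp σ α) (lookup σ j)                ≡⟨ VP.lookup-zipWith _+_ (lookup σ j) (xexp (lookup σ j) v) (permuteExp σ α) ⟩
    lookup (xexp (lookup σ j) v) (lookup σ j) + lookup (permuteExp σ α) (lookup σ j) ≡⟨ cong₂ _+_ diagonal (lookup-permuteExp-σ α j) ⟩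
    v + lookup α j                                                             ∎
    where
    open ≡-Reasoning
    diagonal : lookup (xexp (lookup σ j) v) (lookup σ j) ≡ v
    diagonal = trans (VP.lookup∘tabulate _ (lookup σ j)) (if-does-yes (lookup σ j F.≟ lookup σ j) refl)

-- The raising operator on alternants

raise : ℕ → Poly n → Poly n
raise v P = Σ[ (λ i → Tq i (xpow i v ⊗ P)) ]

raise-cong : ∀ v {P P′ : Poly n} → P ≈ P′ → raise v P ≈ raise v P′
raise-cong v {P} {P′} P≈P′ = Σ-cong (λ i → Tq-cong i {xpow i v ⊗ P} {xpow i v ⊗ P′} (⊗-congʳ (xpow i v) {P} {P′} P≈P′))

altᵗ : Vec ℕ n → Vec (Fin n) n → Term n
altᵗ α σ = term (sign σ) 0 (permuteExp σ α)

xpowᵗ : Fin n → ℕ → Term n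
xpowᵗ i v = term (+ 1) 0 (xexp i v)

Tqᵗ-xpowᵗ-altᵗ : ∀ {σ : Vec (Fin n) n} → σ ∈ perms n → ∀ α v j →
  Tqᵗ (lookup σ j) (mulT (xpowᵗ (lookup σ j) v) (altᵗ α σ)) ≡ mulT (qᵗ (v + lookup α j)) (altᵗ (α ⊞ ve v j) σ)
Tqᵗ-xpowᵗ-altᵗ {σ = σ} σ∈perms α v j = term-cong refl
  (trans (lookup-xexp-⊞-permuteExp σ∈perms α v j) (sym (ℕP.+-identityʳ _)))
  (trans (xexp-⊞-permuteExp σ∈perms α v j) (sym (⊞-identityˡ _)))

∑-[]⊗-alt : ∀ (t : Term n) α f → ∑ ([ t ] ⊗ alt α) f ≡ ∑[ σ ∈ perms n ] f (mulT t (altᵗ α σ))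
∑-[]⊗-alt {n} t α f = begin
  ∑ ([ t ] ⊗ alt α) f                          ≡⟨ trans (∑-concatMap (_·ᵗ alt α) [ t ] f) (ℤP.+-identityʳ _) ⟩
  ∑ (t ·ᵗ alt α) f                             ≡⟨ ∑-map (mulT t) (alt α) f ⟩
  ∑[ u ∈ alt α ] f (mulT t u)                  ≡⟨ ∑-map (altᵗ α) (perms n) _ ⟩
  ∑[ σ ∈ perms n ] f (mulT t (altᵗ α σ))       ∎
  where open ≡-Reasoning

raise-alt : ∀ v (α : Vec ℕ n) → raise v (alt α) ≈ Σ[ (λ j → q^ (v + lookup α j) ⊗ alt (α ⊞ ve v j)) ]
raise-alt {n} v α k β = begin
  coeff (raise v (alt α)) k β                                                                  ≡⟨ coeff-Σ _ k β ⟩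
  ∑[ i ∈ allFin n ] coeff (Tq i (xpow i v ⊗ alt α)) k β                                        ≡⟨ ∑-cong (allFin n) expand-lhs ⟩
  ∑[ i ∈ allFin n ] ∑[ σ ∈ perms n ] coeffᵗ (Tqᵗ i (mulT (xpowᵗ i v) (altᵗ α σ))) k β            ≡⟨ ∑-swap (allFin n) (perms n) _ ⟩
  ∑[ σ ∈ perms n ] ∑[ i ∈ allFin n ] coeffᵗ (Tqᵗ i (mulT (xpowᵗ i v) (altᵗ α σ))) k β            ≡⟨ ∑-cong-∈ (perms n) reindex ⟩
  ∑[ σ ∈ perms n ] ∑[ j ∈ allFin n ] coeffᵗ (mulT (qᵗ (v + lookup α j)) (altᵗ (α ⊞ ve v j) σ)) k β ≡⟨ ∑-swap (perms n) (allFin n) _ ⟩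
  ∑[ j ∈ allFin n ] ∑[ σ ∈ perms n ] coeffᵗ (mulT (qᵗ (v + lookup α j)) (altᵗ (α ⊞ ve v j) σ)) k β ≡⟨ ∑-cong (allFin n) expand-rhs ⟨
  ∑[ j ∈ allFin n ] coeff (q^ (v + lookup α j) ⊗ alt (α ⊞ ve v j)) k β                         ≡⟨ coeff-Σ _ k β ⟨
  coeff (Σ[ (λ j → q^ (v + lookup α j) ⊗ alt (α ⊞ ve v j)) ]) k β                             ∎
  where
  open ≡-Reasoning
  expand-lhs : ∀ i → coeff (Tq i (xpow i v ⊗ alt α)) k β ≡ ∑[ σ ∈ perms n ] coeffᵗ (Tqᵗ i (mulT (xpowᵗ i v) (altᵗ α σ))) k β
  expand-lhs i = trans (coeff-∑ (Tq i (xpow i v ⊗ alt α)) k β)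
    (trans (∑-map (Tqᵗ i) (xpow i v ⊗ alt α) _) (∑-[]⊗-alt (xpowᵗ i v) α (λ u → coeffᵗ (Tqᵗ i u) k β)))
  expand-rhs : ∀ j → coeff (q^ (v + lookup α j) ⊗ alt (α ⊞ ve v j)) k β
                     ≡ ∑[ σ ∈ perms n ] coeffᵗ (mulT (qᵗ (v + lookup α j)) (altᵗ (α ⊞ ve v j) σ)) k β
  expand-rhs j = trans (coeff-∑ (q^ (v + lookup α j) ⊗ alt (α ⊞ ve v j)) k β) (∑-[]⊗-alt (qᵗ (v + lookup α j)) (α ⊞ ve v j) (λ u → coeffᵗ u k β))
  reindex : ∀ {σ} → σ ∈ perms n →
            ∑[ i ∈ allFin n ] coeffᵗ (Tqᵗ i (mulT (xpowᵗ i v) (altᵗ α σ))) k β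
            ≡ ∑[ j ∈ allFin n ] coeffᵗ (mulT (qᵗ (v + lookup α j)) (altᵗ (α ⊞ ve v j) σ)) k β
  reindex σ∈perms = trans (∑-allFin-permute (permutationOf σ∈perms) _)
    (∑-cong (allFin n) (λ j → cong (λ u → coeffᵗ u k β) (Tqᵗ-xpowᵗ-altᵗ σ∈perms α v j)))

q^⊗alt≈Δ⊗q^⊗ : ∀ {α : Vec ℕ n} {S} m → IsSchur α S → q^ m ⊗ alt (α ⊞ δ n) ≈ Δ n ⊗ (q^ m ⊗ S)
q^⊗alt≈Δ⊗q^⊗ {n} {α} {S} m S-schur = begin
  q^ m ⊗ alt (α ⊞ δ n) ≈⟨ ⊗-congʳ (q^ m) {Δ n ⊗ S} {alt (α ⊞ δ n)} S-schur ⟨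
  q^ m ⊗ (Δ n ⊗ S)     ≈⟨ ⊗-left-comm (q^ m) (Δ n) S ⟩
  Δ n ⊗ (q^ m ⊗ S)     ∎
  where open SetoidReasoning (≈-setoid n)

lookup-⊞δ : ∀ (μ : Vec ℕ n) j → lookup (μ ⊞ δ n) j ≡ lookup μ j + (n ∸ suc (toℕ j))
lookup-⊞δ {n} μ j = trans (VP.lookup-zipWith _+_ j μ (δ n)) (cong (_+_ (lookup μ j)) (VP.lookup∘tabulate _ j))

-- Δ is not a zero divisor

weight : Vec ℕ n → ℕ
weight {n} β = ℕ∑.sum (λ k → lookup β k * lookup (δ n) k)

weight-⊞ : ∀ (β γ : Vec ℕ n) → weight (β ⊞ γ) ≡ weight β + weight γ
weight-⊞ {n} β γ = trans (ℕ∑.sum-cong-≗ distrib) (ℕ∑.∑-distrib-+ (λ k → lookup β k * lookup (δ n) k) (λ k → lookup γ k * lookup (δ n) k))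
  where
  distrib : ∀ k → lookup (β ⊞ γ) k * lookup (δ n) k ≡ lookup β k * lookup (δ n) k + lookup γ k * lookup (δ n) k
  distrib k = trans (cong (_* lookup (δ n) k) (VP.lookup-zipWith _+_ k β γ)) (ℕP.*-distribʳ-+ _ (lookup β k) _)

weight-<-cancel : ∀ {β γ α α′ : Vec ℕ n} → β ⊞ α ≡ γ ⊞ α′ → weight γ < weight β → weight α < weight α′
weight-<-cancel {β = β} {γ} {α} {α′} eq γ<β = ℕP.+-cancelˡ-< (weight γ) _ _ (begin-strict
  weight γ + weight α  <⟨ ℕP.+-monoˡ-< (weight α) γ<β ⟩
  weight β + weight α  ≡⟨ weight-⊞ β α ⟨
  weight (β ⊞ α)       ≡⟨ cong weight eq ⟩
  weight (γ ⊞ α′)      ≡⟨ weight-⊞ γ α′ ⟩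
  weight γ + weight α′ ∎)
  where open ℕP.≤-Reasoning

δ-injective : ∀ {i j : Fin n} → lookup (δ n) i ≡ lookup (δ n) j → i ≡ j
δ-injective {n} {i} {j} δi≡δj = FP.toℕ-injective (ℕP.suc-injective (ℕP.+-cancelˡ-≡ (lookup (δ n) i) _ _ (begin
  lookup (δ n) i + suc (toℕ i) ≡⟨ complement i ⟩
  n                            ≡⟨ complement j ⟨
  lookup (δ n) j + suc (toℕ j) ≡⟨ cong (_+ suc (toℕ j)) δi≡δj ⟨
  lookup (δ n) i + suc (toℕ j) ∎)))
  where
  open ≡-Reasoning
  complement : ∀ k → lookup (δ n) k + suc (toℕ k) ≡ n
  complement k = trans (cong (_+ suc (toℕ k)) (VP.lookup∘tabulate _ k)) (ℕP.m∸n+n≡m (FP.toℕ<n k))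

sq-gap : ∀ a b → a * a + b * b ≡ 2 * (a * b) + ∣ a - b ∣ * ∣ a - b ∣
sq-gap a b with ℕP.≤-total a b
... | inj₁ a≤b with record { quotient = t ; equality = refl } ← ℕP.≤⇒≤″ a≤b rewrite ℕP.∣m-m+n∣≡n a t = identity a t
  where
  identity : ∀ a t → a * a + (a + t) * (a + t) ≡ 2 * (a * (a + t)) + t * t
  identity = ℕ-Solver.solve-∀
... | inj₂ b≤a with record { quotient = t ; equality = refl } ← ℕP.≤⇒≤″ b≤a rewrite ℕP.∣-∣-comm (b + t) b | ℕP.∣m-m+n∣≡n b t = identity b t
  where
  identity : ∀ b t → (b + t) * (b + t) + b * b ≡ 2 * ((b + t) * b) + t * t
  identity = ℕ-Solver.solve-∀

module _ {σ : Vec (Fin n) n} (σ∈perms : σ ∈ perms n) where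

  private
    π = permutationOf σ∈perms
    d = lookup (δ n)

  -- Rearrangement inequality: 2 ∑ₖ d(π⁻¹k) d(k) + ∑ₖ |d(π⁻¹k) − d(k)|² = 2 ∑ₖ d(k)², and the second sum is positive unless π = id.
  permuteExp-δ≡δ⊎lighter : permuteExp σ (δ n) ≡ δ n ⊎ weight (permuteExp σ (δ n)) < weight (δ n)
  permuteExp-δ≡δ⊎lighter with FP.all? (λ k → π ⟨$⟩ˡ k F.≟ k)
  ... | yes fixed = inj₁ (Pointwise-≡⇒≡ (ext λ k → trans (lookup-permuteExp σ∈perms (δ n) k) (cong d (fixed k))))
  ... | no moved with k₀ , moved-k₀ ← FP.¬∀⟶∃¬ n _ (λ k → π ⟨$⟩ˡ k F.≟ k) moved =
    inj₂ (ℕP.*-cancelˡ-< 2 _ _ (begin-strict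
      2 * weight (permuteExp σ (δ n))                                   <⟨ ℕP.m<m+n _ gap-positive ⟩
      2 * weight (permuteExp σ (δ n)) + gap                             ≡⟨ cong₂ _+_ (cong (2 *_) weight-σδ) refl ⟩
      2 * ℕ∑.sum (λ k → d (τ k) * d k) + gap                            ≡⟨ cong (_+ gap) (ℕ∑.*-distribˡ-sum 2 (λ k → d (τ k) * d k)) ⟩
      ℕ∑.sum (λ k → 2 * (d (τ k) * d k)) + gap                          ≡⟨ ℕ∑.∑-distrib-+ (λ k → 2 * (d (τ k) * d k)) (λ k → ∣ d (τ k) - d k ∣ * ∣ d (τ k) - d k ∣) ⟨
      ℕ∑.sum (λ k → 2 * (d (τ k) * d k) + ∣ d (τ k) - d k ∣ * ∣ d (τ k) - d k ∣) ≡⟨ ℕ∑.sum-cong-≗ (λ k → sq-gap (d (τ k)) (d k)) ⟨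
      ℕ∑.sum (λ k → d (τ k) * d (τ k) + d k * d k)                      ≡⟨ ℕ∑.∑-distrib-+ (λ k → d (τ k) * d (τ k)) (λ k → d k * d k) ⟩
      ℕ∑.sum (λ k → d (τ k) * d (τ k)) + ℕ∑.sum (λ k → d k * d k)        ≡⟨ cong (_+ weight (δ n)) (ℕ∑.∑-permute (λ k → d k * d k) (flip π)) ⟨
      weight (δ n) + weight (δ n)                                       ≡⟨ cong (_+_ (weight (δ n))) (ℕP.+-identityʳ _) ⟨
      2 * weight (δ n)                                                  ∎))
    where
    open ℕP.≤-Reasoning
    τ = π ⟨$⟩ˡ_
    gap = ℕ∑.sum (λ k → ∣ d (τ k) - d k ∣ * ∣ d (τ k) - d k ∣)
    weight-σδ : weight (permuteExp σ (δ n)) ≡ ℕ∑.sum (λ k → d (τ k) * d k)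
    weight-σδ = ℕ∑.sum-cong-≗ (λ k → cong (_* d k) (lookup-permuteExp σ∈perms (δ n) k))
    square-pos : ∀ {t} → 0 < t → 0 < t * t
    square-pos {suc t} _ = ℕ.z<s
    gap-positive : 0 < gap
    gap-positive = ℕP.<-≤-trans (square-pos (ℕP.n≢0⇒n>0 (moved-k₀ ∘ δ-injective ∘ ℕP.∣m-n∣≡0⇒m≡n))) (term≤sum _ k₀)

  permuteExp-δ-fixed⇒sign≡1 : permuteExp σ (δ n) ≡ δ n → sign σ ≡ + 1
  permuteExp-δ-fixed⇒sign≡1 fixed = cong (ℤ._^_ (ℤ.- + 1)) (cong length (LP.filter-none _ (All.universal no-inversion (pairs n))))
    where
    σ-identity : ∀ j → lookup σ j ≡ j
    σ-identity j = δ-injective (trans (cong (λ γ → lookup γ (lookup σ j)) (sym fixed)) (lookup-permuteExp-σ σ∈perms (δ n) j))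
    no-inversion : ∀ ((i , j) : Fin n × Fin n) → ¬ T ((i <ꟳ j) ∧ (lookup σ j <ꟳ lookup σ i))
    no-inversion (i , j) inversion rewrite σ-identity i | σ-identity j
      with i<j , j<i ← Equivalence.to (BP.T-∧ {i <ꟳ j} {j <ꟳ i}) inversion = ℕP.<-asym (ℕP.<ᵇ⇒< (toℕ i) (toℕ j) i<j) (ℕP.<ᵇ⇒< (toℕ j) (toℕ i) j<i)

identity-fixes-δ : ∀ n → permuteExp (tabulate id) (δ n) ≡ δ n
identity-fixes-δ n = Pointwise-≡⇒≡ (ext λ k → trans (lookup-permuteExp id∈perms (δ n) k) (cong (lookup (δ n)) (π⁻¹k≡k k)))
  where
  id∈perms = identity-∈-perms n
  π⁻¹k≡k : ∀ k → permutationOf id∈perms ⟨$⟩ˡ k ≡ k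
  π⁻¹k≡k k = trans (sym (VP.lookup∘tabulate id _)) (inverseʳ (permutationOf id∈perms))

maximal-coefficient : ∀ (w : Vec ℕ n → ℕ) (P : Poly n) {k α} → coeff P k α ≢ + 0 →
  ∃₂ λ k₀ α₀ → coeff P k₀ α₀ ≢ + 0 × (∀ {k′ α′} → coeff P k′ α′ ≢ + 0 → w α′ ≤ w α₀)
maximal-coefficient w P nonzero with t₀ , _ , refl , refl ← support P nonzero =
  qdeg m , xdeg m , m-nonzero , maximal
  where
  Nonzero : Term _ → Set
  Nonzero t = coeff P (qdeg t) (xdeg t) ≢ + 0
  nonzero? : ∀ t → Dec (Nonzero t)
  nonzero? t = ¬? (coeff P (qdeg t) (xdeg t) ℤ.≟ + 0)
  candidates = filter nonzero? P
  m = argmax (w ∘ xdeg) t₀ candidates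
  m-nonzero : Nonzero m
  m-nonzero = argmax-all (w ∘ xdeg) {P = Nonzero} nonzero (all-filter nonzero? P)
  maximal : ∀ {k′ α′} → coeff P k′ α′ ≢ + 0 → w α′ ≤ w (xdeg m)
  maximal nonzero′ with u , u∈P , refl , refl ← support P nonzero′ =
    All.lookup (f[xs]≤f[argmax] t₀ candidates) (∈-filter⁺ nonzero? u∈P nonzero′)

fixes-δ? : ∀ (σ : Vec (Fin n) n) → Dec (permuteExp σ (δ n) ≡ δ n)
fixes-δ? {n} σ = VP.≡-dec ℕ._≟_ (permuteExp σ (δ n)) (δ n)

MaxWeight : Poly n → Vec ℕ n → Set
MaxWeight P α₀ = ∀ {k α} → coeff P k α ≢ + 0 → weight α ≤ weight α₀

-- σx^δ with σδ ≠ δ is lighter than x^δ, so it reaches x^(δ+α₀) only from a monomial of P heavier than x^α₀.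
coeff-altᵗ-·ᵗ-maximal : ∀ {σ : Vec (Fin n) n} → σ ∈ perms n → ∀ (P : Poly n) k₀ {α₀} → MaxWeight P α₀ →
  coeff (altᵗ (δ n) σ ·ᵗ P) k₀ (δ n ⊞ α₀) ≡ (if does (fixes-δ? σ) then coeff P k₀ α₀ else + 0)
coeff-altᵗ-·ᵗ-maximal {n} {σ} σ∈perms P k₀ {α₀} maximal with permuteExp-δ≡δ⊎lighter σ∈perms
... | inj₁ fixed = begin
  coeff (t ·ᵗ P) k₀ (δ n ⊞ α₀)                      ≡⟨ cong (λ γ → coeff (t ·ᵗ P) k₀ (γ ⊞ α₀)) fixed ⟨
  coeff (t ·ᵗ P) (0 + k₀) (permuteExp σ (δ n) ⊞ α₀) ≡⟨ coeff-·ᵗ-∣ t P k₀ α₀ ⟩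
  sign σ ℤ.* coeff P k₀ α₀                          ≡⟨ cong (ℤ._* coeff P k₀ α₀) (permuteExp-δ-fixed⇒sign≡1 σ∈perms fixed) ⟩
  + 1 ℤ.* coeff P k₀ α₀                             ≡⟨ ℤP.*-identityˡ _ ⟩
  coeff P k₀ α₀                                     ≡⟨ if-does-yes (fixes-δ? σ) fixed ⟨
  (if does (fixes-δ? σ) then coeff P k₀ α₀ else + 0) ∎
  where
  open ≡-Reasoning
  t = altᵗ (δ n) σ
... | inj₂ lighter = trans vanishes (sym (if-does-no (fixes-δ? σ) (λ fixed → ℕP.<-irrefl (cong weight fixed) lighter)))
  where
  t = altᵗ (δ n) σ
  vanishes : coeff (t ·ᵗ P) k₀ (δ n ⊞ α₀) ≡ + 0
  vanishes with t ∣ᵗ? (k₀ , δ n ⊞ α₀)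
  ... | no  t∤ = coeff-·ᵗ-∤ t P t∤
  ... | yes (k′ , α′ , refl , eq) = trans (cong (coeff (t ·ᵗ P) k′) eq)
    (trans (coeff-·ᵗ-∣ t P k′ α′) (trans (cong (ℤ._*_ (sign σ)) beyond-maximal) (ℤP.*-zeroʳ (sign σ))))
    where
    beyond-maximal : coeff P k′ α′ ≡ + 0
    beyond-maximal with coeff P k′ α′ ℤ.≟ + 0
    ... | yes vanishing = vanishing
    ... | no  nonzero   = contradiction (maximal nonzero) (ℕP.<⇒≱ (weight-<-cancel eq lighter))

coeff-Δ⊗-maximal : ∀ (P : Poly n) k₀ {α₀} → MaxWeight P α₀ →
  coeff (Δ n ⊗ P) k₀ (δ n ⊞ α₀) ≡ + length (filter fixes-δ? (perms n)) ℤ.* coeff P k₀ α₀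
coeff-Δ⊗-maximal {n} P k₀ {α₀} maximal = begin
  coeff (Δ n ⊗ P) k₀ (δ n ⊞ α₀)                                          ≡⟨ coeff-⊗ (Δ n) P k₀ _ ⟩
  ∑[ t ∈ Δ n ] coeff (t ·ᵗ P) k₀ (δ n ⊞ α₀)                               ≡⟨ ∑-map (altᵗ (δ n)) (perms n) _ ⟩
  ∑[ σ ∈ perms n ] coeff (altᵗ (δ n) σ ·ᵗ P) k₀ (δ n ⊞ α₀)                 ≡⟨ ∑-cong-∈ (perms n) (λ σ∈perms → coeff-altᵗ-·ᵗ-maximal σ∈perms P k₀ maximal) ⟩
  ∑[ σ ∈ perms n ] (if does (fixes-δ? σ) then coeff P k₀ α₀ else + 0)     ≡⟨ ∑-count fixes-δ? (perms n) _ ⟩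
  + length (filter fixes-δ? (perms n)) ℤ.* coeff P k₀ α₀                 ∎
  where open ≡-Reasoning

Δ⊗P≈0⇒P≈0 : ∀ (P : Poly n) → Δ n ⊗ P ≈ 0ₚ → P ≈ 0ₚ
Δ⊗P≈0⇒P≈0 {n} P Δ⊗P≈0 k α with coeff P k α ℤ.≟ + 0
... | yes vanishing = vanishing
... | no  nonzero
  with k₀ , α₀ , leading≢0 , maximal ← maximal-coefficient weight P nonzero
  with ℤP.i*j≡0⇒i≡0∨j≡0 (+ _) (trans (sym (coeff-Δ⊗-maximal P k₀ maximal)) (Δ⊗P≈0 k₀ (δ n ⊞ α₀)))
... | inj₁ count≡0   = contradiction (ℤP.+-injective count≡0) (ℕP.n>0⇒n≢0 count-positive)
  where
  count-positive : 0 < length (filter fixes-δ? (perms n))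
  count-positive = LP.filter-some fixes-δ? (Any.map (λ { refl → identity-fixes-δ n }) (identity-∈-perms n))
... | inj₂ leading≡0 = contradiction leading≡0 leading≢0

Δ⊗-cancelˡ : ∀ {R Q : Poly n} → Δ n ⊗ R ≈ Δ n ⊗ Q → R ≈ Q
Δ⊗-cancelˡ {n} {R} {Q} Δ⊗R≈Δ⊗Q k α = ℤP.i-j≡0⇒i≡j _ _ (trans (sym (coeff-⊖ R Q k α)) (Δ⊗P≈0⇒P≈0 (R ⊖ Q) Δ⊗[R⊖Q]≈0 k α))
  where
  Δ⊗[R⊖Q]≈0 : Δ n ⊗ (R ⊖ Q) ≈ 0ₚ
  Δ⊗[R⊖Q]≈0 k α = trans (coeff-⊗-⊖ (Δ n) R Q k α) (ℤP.i≡j⇒i-j≡0 (Δ⊗R≈Δ⊗Q k α))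

proposition4p1 : (n : ℕ) → 1 ≤ n → (v : ℕ) → (μ : Vec ℕ n) → IsPartition μ →
    (S : Poly n) → IsSchur μ S →
    (Sₑ : Fin n → Poly n) → (∀ i → IsSchur (zipWith _+_ μ (ve v i)) (Sₑ i)) →
    (R : Poly n) → IsRv v S R →
    R ≈ Σ[ (λ i → q^ (v + lookup μ i + (n ∸ suc (toℕ i))) ⊗ Sₑ i) ]
proposition4p1 n _ v μ _ S S-schur Sₑ Sₑ-schur R R-def = Δ⊗-cancelˡ (begin
  Δ n ⊗ R                                                         ≈⟨ R-def ⟩
  raise v (Δ n ⊗ S)                                               ≈⟨ raise-cong v S-schur ⟩
  raise v (alt (μ ⊞ δ n))                                         ≈⟨ raise-alt v (μ ⊞ δ n) ⟩
  Σ[ (λ j → q^ (v + lookup (μ ⊞ δ n) j) ⊗ alt (μ ⊞ δ n ⊞ ve v j)) ] ≈⟨ Σ-cong summand ⟩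
  Σ[ (λ j → Δ n ⊗ (q^ (c j) ⊗ Sₑ j)) ]                            ≈⟨ ⊗-distrib-Σ (Δ n) (λ j → q^ (c j) ⊗ Sₑ j) ⟨
  Δ n ⊗ Σ[ (λ j → q^ (c j) ⊗ Sₑ j) ]                              ∎)
  where
  open SetoidReasoning (≈-setoid n)
  c : Fin n → ℕ
  c j = v + lookup μ j + (n ∸ suc (toℕ j))
  summand : ∀ j → q^ (v + lookup (μ ⊞ δ n) j) ⊗ alt (μ ⊞ δ n ⊞ ve v j) ≈ Δ n ⊗ (q^ (c j) ⊗ Sₑ j)
  summand j = begin
    q^ (v + lookup (μ ⊞ δ n) j) ⊗ alt (μ ⊞ δ n ⊞ ve v j) ≡⟨ cong₂ (λ m γ → q^ m ⊗ alt γ)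
                                                              (trans (cong (_+_ v) (lookup-⊞δ μ j)) (sym (ℕP.+-assoc v _ _)))
                                                              (⊞-right-comm μ (δ n) (ve v j)) ⟩
    q^ (c j) ⊗ alt (μ ⊞ ve v j ⊞ δ n)                     ≈⟨ q^⊗alt≈Δ⊗q^⊗ {α = μ ⊞ ve v j} (c j) (Sₑ-schur j) ⟩
    Δ n ⊗ (q^ (c j) ⊗ Sₑ j)                               ∎
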